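{- For a presheaf $\Gamma$ over $\mathrm{BPCube}$, the following are equivalent: (1) $\Gamma$ is discrete; (2) $\Gamma$ is isomorphic to $\Delta\Theta$ for some presheaf $\Theta$ over $\mathrm{Cube}$; (3) the map $\kappa_\Gamma:\flat\Gamma\to\Gamma$ is an isomorphism.
   Context: Fix an infinite set of names. $\mathrm{Cube}$: objects are finite sets of names; a morphism $\varphi:V\to W$ assigns to each $i\in W$ an element of $\{0,1\}\cup V$; composition is substitution. $\mathrm{BPCube}$: objects are pairs $W=(W_{\mathbb B},W_{\mathbb P})$ of disjoint finite sets of names; $(W,i:\mathbb P)$ denotes $(W_{\mathbb B},W_{\mathbb P}\uplus\{i\})$; a morphism $\varphi:V\to W$ assigns to each $i\in W_{\mathbb B}$ an element of $\{0,1\}\cup V_{\mathbb B}$ and to each $i\in W_{\mathbb P}$ an element of $\{0,1\}\cup V_{\mathbb B}\cup V_{\mathbb P}$; $\mathrm{wk}_i:(W,i:\mathbb P)\to W$ sends every name of $W$ to itself. The functor $\sqcap:\mathrm{BPCube}\to\mathrm{Cube}$ sends $W$ to $W_{\mathbb B}$ and $\varphi:V\to W$ to the map $V_{\mathbb B}\to W_{\mathbb B}$ with $i\mapsto i\langle\varphi\rangle$ for $i\in W_{\mathbb B}$. $\Delta:\widehat{\mathrm{Cube}}\to\widehat{\mathrm{BPCube}}$ is precomposition with $\sqcap$. The functor $\mathrm{shp}:\mathrm{BPCube}\to\mathrm{BPCube}$ sends $W$ to $(W_{\mathbb B},\emptyset)$ and $\varphi$ to its restriction to bridge names; $\varsigma_W:W\to\mathrm{shp}\,W$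 sends each name of $W_{\mathbb B}$ to itself. $\flat$ is precomposition with $\mathrm{shp}$, i.e. $(\flat\Gamma)(W)=\Gamma(\mathrm{shp}\,W)$, and $\kappa_\Gamma:\flat\Gamma\to\Gamma$ sends $\gamma\in\Gamma(\mathrm{shp}\,W)$ to its restriction along $\varsigma_W$. A presheaf $\Gamma$ over $\mathrm{BPCube}$ is discrete if every $\gamma\in\Gamma(W,i:\mathbb P)$ (for all $W$ and fresh path names $i$) is of the form $\gamma'\cdot\mathrm{wk}_i$ for some $\gamma'\in\Gamma(W)$. -}

module Defs where

open import Level using (Level; _⊔_) renaming (suc to lsuc)
open import Data.Nat using (ℕ; suc)
open import Data.Fin using (Fin; punchIn)
open import Data.Vec using (Vec; []; map; tabulate; lookup)
open import Data.Vec.Properties using (tabulate-∘; tabulate∘lookup; lookup∘tabulate)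
open import Data.Product using (Σ; _,_)
open import Relation.Binary.PropositionalEquality
  using (_≡_; refl; sym; trans; cong; cong₂)

record Cat : Set₁ where
  field
    Ob   : Set
    Hom  : Ob → Ob → Set
    idC  : (W : Ob) → Hom W W
    _∘C_ : {U V W : Ob} → Hom V W → Hom U V → Hom U W

record Presheaf (C : Cat) (ℓ : Level) : Set (lsuc ℓ) where
  open Cat C
  field
    F₀       : Ob → Set ℓ
    _·_      : {V W : Ob} → F₀ W → Hom V W → F₀ V
    ·-id     : {W : Ob} (γ : F₀ W) → γ · idC W ≡ γ
    ·-comp   : {U V W : Ob} (γ : F₀ W) (φ : Hom V W) (ψ : Hom U V) →
               (γ · φ) · ψ ≡ γ · (φ ∘C ψ)

record NatTrans {C : Cat} {ℓ ℓ' : Level}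
                (F : Presheaf C ℓ) (G : Presheaf C ℓ') : Set (ℓ ⊔ ℓ') where
  open Cat C
  private
    module F = Presheaf F
    module G = Presheaf G
  field
    η       : (W : Ob) → F.F₀ W → G.F₀ W
    natural : {V W : Ob} (φ : Hom V W) (γ : F.F₀ W) →
              η V (γ F.· φ) ≡ (η W γ) G.· φ
open NatTrans public

IsIso : {C : Cat} {ℓ ℓ' : Level} {F : Presheaf C ℓ} {G : Presheaf C ℓ'} →
        NatTrans F G → Set (ℓ ⊔ ℓ')
IsIso {C} {F = F} {G = G} α =
  Σ (NatTrans G F) λ β →
    ((W : Cat.Ob C) (x : Presheaf.F₀ F W) → η β W (η α W x) ≡ x) ×'
    ((W : Cat.Ob C) (y : Presheaf.F₀ G W) → η α W (η β W y) ≡ y)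
  where
    open import Data.Product using () renaming (_×_ to _×'_)

_≅_ : {C : Cat} {ℓ ℓ' : Level} → Presheaf C ℓ → Presheaf C ℓ' → Set (ℓ ⊔ ℓ')
F ≅ G = Σ (NatTrans F G) IsIso

-- The cube category Cube (skeletal presentation: the finite set of
-- names of an object n is Fin n).

data Val (m : ℕ) : Set where
  e0 e1 : Val m
  var   : Fin m → Val m

-- a morphism φ : m → n assigns to each i ∈ Fin n an element of {0,1} ∪ Fin m
CHom : ℕ → ℕ → Set
CHom m n = Vec (Val m) n

substVal : {k m : ℕ} → CHom k m → Val m → Val k
substVal ψ e0      = e0
substVal ψ e1      = e1
substVal ψ (var j) = lookup ψ j

cid : (n : ℕ) → CHom n n
cid n = tabulate var

_∘c_ : {k m n : ℕ} → CHom m n → CHom k m → CHom k n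
φ ∘c ψ = map (substVal ψ) φ

Cube : Cat
Cube = record { Ob = ℕ ; Hom = CHom ; idC = cid ; _∘C_ = _∘c_ }

record BPOb : Set where
  constructor ⟨_,_⟩
  field
    bn : ℕ   -- number of bridge names  (W_B = Fin bn)
    pn : ℕ   -- number of path names    (W_P = Fin pn)
open BPOb public

data PVal (b p : ℕ) : Set where
  pe0 pe1 : PVal b p
  bvar    : Fin b → PVal b p
  pvar    : Fin p → PVal b p

record BPHom (V W : BPOb) : Set where
  constructor mkHom
  field
    bmap : Vec (Val (bn V)) (bn W)
    pmap : Vec (PVal (bn V) (pn V)) (pn W)
open BPHom public

valToP : {b p : ℕ} → Val b → PVal b p
valToP e0      = pe0
valToP e1      = pe1
valToP (var j) = bvar j

substP : {U V : BPOb} → BPHom U V → PVal (bn V) (pn V) → PVal (bn U) (pn U)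
substP ψ pe0      = pe0
substP ψ pe1      = pe1
substP ψ (bvar j) = valToP (lookup (bmap ψ) j)
substP ψ (pvar j) = lookup (pmap ψ) j

bpid : (W : BPOb) → BPHom W W
bpid W = mkHom (tabulate var) (tabulate pvar)

_∘bp_ : {U V W : BPOb} → BPHom V W → BPHom U V → BPHom U W
φ ∘bp ψ = mkHom (map (substVal (bmap ψ)) (bmap φ)) (map (substP ψ) (pmap φ))

BPCube : Cat
BPCube = record { Ob = BPOb ; Hom = BPHom ; idC = bpid ; _∘C_ = _∘bp_ }

-- (W , i : P): W extended by a fresh path name inserted at position k
-- (all positions k : Fin (suc pn) are considered, matching "every fresh i")
-- wk k : (W , i : P) → W sends every name of W to itself
wk : (W : BPOb) (k : Fin (suc (pn W))) → BPHom ⟨ bn W , suc (pn W) ⟩ W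
wk W k = mkHom (tabulate var) (tabulate (λ j → pvar (punchIn k j)))

⊓₀ : BPOb → ℕ
⊓₀ W = bn W

⊓₁ : {V W : BPOb} → BPHom V W → CHom (⊓₀ V) (⊓₀ W)
⊓₁ φ = bmap φ

Δ : {ℓ : Level} → Presheaf Cube ℓ → Presheaf BPCube ℓ
Δ Θ = record
  { F₀     = λ W → F₀ (⊓₀ W)
  ; _·_    = λ γ φ → γ · ⊓₁ φ
  ; ·-id   = λ γ → ·-id γ
  ; ·-comp = λ γ φ ψ → ·-comp γ (⊓₁ φ) (⊓₁ ψ)
  }
  where open Presheaf Θ

shp₀ : BPOb → BPOb
shp₀ W = ⟨ bn W , 0 ⟩

shp₁ : {V W : BPOb} → BPHom V W → BPHom (shp₀ V) (shp₀ W)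
shp₁ φ = mkHom (bmap φ) []

ς : (W : BPOb) → BPHom W (shp₀ W)
ς W = mkHom (tabulate var) []

♭ : {ℓ : Level} → Presheaf BPCube ℓ → Presheaf BPCube ℓ
♭ Γ = record
  { F₀     = λ W → F₀ (shp₀ W)
  ; _·_    = λ γ φ → γ · shp₁ φ
  ; ·-id   = λ γ → ·-id γ
  ; ·-comp = λ γ φ ψ → ·-comp γ (shp₁ φ) (shp₁ ψ)
  }
  where open Presheaf Γ

substVal-id : {m : ℕ} (v : Val m) → substVal (tabulate var) v ≡ v
substVal-id e0      = refl
substVal-id e1      = refl
substVal-id (var j) = lookup∘tabulate var j

map-substVal-id : {m n : ℕ} (xs : Vec (Val m) n) → map (substVal (tabulate var)) xs ≡ xs
map-substVal-id []       = refl
map-substVal-id (x Data.Vec.∷ xs) = cong₂ Data.Vec._∷_ (substVal-id x) (map-substVal-id xs)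

map-id-subst : {m n : ℕ} (φ : Vec (Val m) n) → map (substVal φ) (tabulate var) ≡ φ
map-id-subst φ = trans (sym (tabulate-∘ (substVal φ) var)) (tabulate∘lookup φ)

ς-natural : {V W : BPOb} (φ : BPHom V W) → (shp₁ φ ∘bp ς V) ≡ (ς W ∘bp φ)
ς-natural φ = cong (λ v → mkHom v []) (trans (map-substVal-id (bmap φ)) (sym (map-id-subst (bmap φ))))

κ : {ℓ : Level} (Γ : Presheaf BPCube ℓ) → NatTrans (♭ Γ) Γ
κ Γ = record
  { η       = λ W γ → γ · ς W
  ; natural = λ {V} {W} φ γ →
      trans (·-comp γ (shp₁ φ) (ς V))
        (trans (cong (γ ·_) (ς-natural φ)) (sym (·-comp γ (ς W) φ)))
  }
  where open Presheaf Γ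

Discrete : {ℓ : Level} → Presheaf BPCube ℓ → Set ℓ
Discrete Γ =
  (W : BPOb) (k : Fin (suc (pn W))) (γ : F₀ ⟨ bn W , suc (pn W) ⟩) →
  Σ (F₀ W) λ γ' → γ ≡ γ' · wk W k
  where open Presheaf Γ

module Submission where

-- Write Θ_Γ for the restriction of Γ to the bridge-only cubes ⟨ b , 0 ⟩,
-- a presheaf over Cube.  By construction ♭ Γ and Δ Θ_Γ are the same
-- presheaf, so the theorem follows from the cycle
--   (1) discrete  ⇒  (3) κ_Γ iso  ⇒  (2) Γ ≅ Δ Θ  ⇒  (1) discrete.
-- (1 ⇒ 3): ς_W : W → shp W has the section ι_W sending path names to 0,
--   so restriction along ς_W is injective; discreteness lets us strip the
--   path names one at a time (using ς ∘ wk = ς), so it is also surjective.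
--   A componentwise bijective natural transformation is an isomorphism.
-- (3 ⇒ 2): an inverse of κ_Γ is an isomorphism Γ ≅ ♭ Γ = Δ Θ_Γ.
-- (2 ⇒ 1): every Δ Θ is discrete, since ⊓ sends wk to the identity, and a
--   retract of a discrete presheaf is discrete.

open import Defs
open import Level using (Level)
open import Data.Product using (Σ; _×_; _,_; proj₁; proj₂)
open import Function.Bundles using (_⇔_; mk⇔)
open import Data.Nat using (ℕ; zero; suc)
open import Data.Fin using (Fin)
import Data.Fin as Fin
open import Data.Vec using ([]; tabulate)
open import Relation.Binary.PropositionalEquality
  using (_≡_; sym; cong; module ≡-Reasoning)

module _ {C : Cat} where
  open Cat C

  restrict-injective : {ℓ : Level} (F : Presheaf C ℓ) {V W : Ob}
    (f : Hom V W) (s : Hom W V) → (f ∘C s) ≡ idC W →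
    {x y : Presheaf.F₀ F W} → Presheaf._·_ F x f ≡ Presheaf._·_ F y f → x ≡ y
  restrict-injective F f s fs≡id {x} {y} xf≡yf = begin
    x                 ≡⟨ sym (·-id x) ⟩
    x · idC _         ≡⟨ cong (x ·_) (sym fs≡id) ⟩
    x · (f ∘C s)      ≡⟨ sym (·-comp x f s) ⟩
    (x · f) · s       ≡⟨ cong (_· s) xf≡yf ⟩
    (y · f) · s       ≡⟨ ·-comp y f s ⟩
    y · (f ∘C s)      ≡⟨ cong (y ·_) fs≡id ⟩
    y · idC _         ≡⟨ ·-id y ⟩
    y                 ∎
    where
      open Presheaf F
      open ≡-Reasoning

  componentwise-iso : {ℓ ℓ' : Level} {F : Presheaf C ℓ} {G : Presheaf C ℓ'}
    (α : NatTrans F G) (β : (W : Ob) → Presheaf.F₀ G W → Presheaf.F₀ F W) →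
    ((W : Ob) (x : Presheaf.F₀ F W) → β W (η α W x) ≡ x) →
    ((W : Ob) (y : Presheaf.F₀ G W) → η α W (β W y) ≡ y) →
    IsIso α
  componentwise-iso {F = F} {G} α β βα≡id αβ≡id =
    record { η = β ; natural = β-natural } , βα≡id , αβ≡id
    where
      module F = Presheaf F
      module G = Presheaf G
      open ≡-Reasoning
      β-natural : {V W : Ob} (φ : Hom V W) (y : G.F₀ W) →
                  β V (y G.· φ) ≡ β W y F.· φ
      β-natural {V} {W} φ y = begin
        β V (y G.· φ)                  ≡⟨ cong (λ z → β V (z G.· φ)) (sym (αβ≡id W y)) ⟩
        β V (η α W (β W y) G.· φ)      ≡⟨ cong (β V) (sym (natural α φ (β W y))) ⟩
        β V (η α V (β W y F.· φ))      ≡⟨ βα≡id V (β W y F.· φ) ⟩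
        β W y F.· φ                    ∎

ι : (W : BPOb) → BPHom (shp₀ W) W
ι W = mkHom (tabulate var) (tabulate (λ _ → pe0))

ς∘ι≡id : (W : BPOb) → (ς W ∘bp ι W) ≡ bpid (shp₀ W)
ς∘ι≡id W = cong (λ v → mkHom v []) (map-substVal-id (tabulate var))

ς∘wk≡ς : (W : BPOb) (k : Fin (suc (pn W))) →
         (ς W ∘bp wk W k) ≡ ς ⟨ bn W , suc (pn W) ⟩
ς∘wk≡ς W k = cong (λ v → mkHom v []) (map-substVal-id (tabulate var))

-- Every presheaf Δ Θ is discrete: ⊓ sends wk to the identity cube map.
Δ-discrete : {ℓ : Level} (Θ : Presheaf Cube ℓ) → Discrete (Δ Θ)
Δ-discrete Θ W k γ = γ , sym (Presheaf.·-id Θ γ)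

retract-discrete : {ℓ ℓ' : Level} {Γ : Presheaf BPCube ℓ} {Γ' : Presheaf BPCube ℓ'}
  (α : NatTrans Γ Γ') (β : NatTrans Γ' Γ) →
  ((W : BPOb) (x : Presheaf.F₀ Γ W) → η β W (η α W x) ≡ x) →
  Discrete Γ' → Discrete Γ
retract-discrete {Γ = Γ} {Γ'} α β βα≡id D' W k γ with D' W k (η α _ γ)
... | γ' , αγ≡γ'wk = η β W γ' , (begin
  γ                                   ≡⟨ sym (βα≡id _ γ) ⟩
  η β _ (η α _ γ)                     ≡⟨ cong (η β _) αγ≡γ'wk ⟩
  η β _ (Presheaf._·_ Γ' γ' (wk W k)) ≡⟨ natural β (wk W k) γ' ⟩
  Presheaf._·_ Γ (η β W γ') (wk W k)  ∎)
  where open ≡-Reasoning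

module _ {ℓ : Level} (Γ : Presheaf BPCube ℓ) where
  open Presheaf Γ

  -- Θ_Γ: the restriction of Γ to bridge-only cubes; ♭ Γ is Δ Θ_Γ.
  bridgeRestriction : Presheaf Cube ℓ
  bridgeRestriction = record
    { F₀     = λ n → F₀ ⟨ n , 0 ⟩
    ; _·_    = λ γ φ → γ · mkHom φ []
    ; ·-id   = λ γ → ·-id γ
    ; ·-comp = λ γ φ ψ → ·-comp γ (mkHom φ []) (mkHom ψ [])
    }

  -- For a discrete Γ, every element is restricted along ς from its shape:
  -- remove the path names one at a time (induction on their number).
  ς-surjective : Discrete Γ → (W : BPOb) (γ : F₀ W) →
                 Σ (F₀ (shp₀ W)) λ γ₀ → γ₀ · ς W ≡ γ
  ς-surjective D W = strip (bn W) (pn W)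
    where
      strip : (b p : ℕ) (γ : F₀ ⟨ b , p ⟩) →
              Σ (F₀ ⟨ b , 0 ⟩) λ γ₀ → γ₀ · ς ⟨ b , p ⟩ ≡ γ
      strip b zero γ = γ , ·-id γ
      strip b (suc p) γ with D ⟨ b , p ⟩ Fin.zero γ
      ... | γ₁ , γ≡γ₁wk with strip b p γ₁
      ... | γ₀ , γ₀ς≡γ₁ = γ₀ , (begin
        γ₀ · ς ⟨ b , suc p ⟩                 ≡⟨ cong (γ₀ ·_) (sym (ς∘wk≡ς V Fin.zero)) ⟩
        γ₀ · (ς V ∘bp wk V Fin.zero)         ≡⟨ sym (·-comp γ₀ (ς V) (wk V Fin.zero)) ⟩
        (γ₀ · ς V) · wk V Fin.zero           ≡⟨ cong (_· wk V Fin.zero) γ₀ς≡γ₁ ⟩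
        γ₁ · wk V Fin.zero                   ≡⟨ sym γ≡γ₁wk ⟩
        γ                                    ∎)
        where
          V = ⟨ b , p ⟩
          open ≡-Reasoning

  discrete⇒κ-iso : Discrete Γ → IsIso (κ Γ)
  discrete⇒κ-iso D = componentwise-iso (κ Γ) shape shape-left shape-right
    where
      shape : (W : BPOb) → F₀ W → F₀ (shp₀ W)
      shape W γ = proj₁ (ς-surjective D W γ)
      shape-right : (W : BPOb) (γ : F₀ W) → shape W γ · ς W ≡ γ
      shape-right W γ = proj₂ (ς-surjective D W γ)
      shape-left : (W : BPOb) (x : F₀ (shp₀ W)) → shape W (x · ς W) ≡ x
      shape-left W x =
        restrict-injective Γ (ς W) (ι W) (ς∘ι≡id W) (shape-right W (x · ς W))

  -- (3) ⇒ (2): inverting κ_Γ gives Γ ≅ ♭ Γ, which is Δ Θ_Γ.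
  κ-iso⇒Δ-image : IsIso (κ Γ) → Σ (Presheaf Cube ℓ) (λ Θ → Γ ≅ Δ Θ)
  κ-iso⇒Δ-image (β , βκ≡id , κβ≡id) =
    bridgeRestriction , β , κ Γ , κβ≡id , βκ≡id

  Δ-image⇒discrete : Σ (Presheaf Cube ℓ) (λ Θ → Γ ≅ Δ Θ) → Discrete Γ
  Δ-image⇒discrete (Θ , α , β , βα≡id , _) =
    retract-discrete α β βα≡id (Δ-discrete Θ)

mainTheorem11 : {ℓ : Level} (Γ : Presheaf BPCube ℓ) →
    (Discrete Γ ⇔ Σ (Presheaf Cube ℓ) (λ Θ → Γ ≅ Δ Θ)) ×
    (Discrete Γ ⇔ IsIso (κ Γ))
mainTheorem11 Γ =
  mk⇔ (λ D → κ-iso⇒Δ-image Γ (discrete⇒κ-iso Γ D)) (Δ-image⇒discrete Γ) ,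
  mk⇔ (discrete⇒κ-iso Γ) (λ I → Δ-image⇒discrete Γ (κ-iso⇒Δ-image Γ I))
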